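{- Let $M\ge 2$ and $N\ge 4$ be even integers. Then the polygons $\mathcal{V}_{M,N}$ and $\mathcal{W}_{M,N}$ are normally equivalent.
   Context: Let $\vec h(x):=(x,\ x^2-x)^\top\in\mathbb{R}^2$ for $x\in\mathbb{R}$. For $M\in\mathbb{N}$ and even $N\in\mathbb{N}$, for $j\in\{0,\dots,N/2-1\}$ and $\ell\in\{0,1\}$ define $\vec v_{j,\ell}:=\vec h\!\left(\frac{2M(j+\ell)-\ell}{MN-1}\right)$ and $\vec w_{j,\ell}:=\vec h\!\left(\frac{M(2j+1)-(1-\ell)}{MN-1}\right)$, and let $\mathcal V_{M,N}:=\operatorname{conv}\{\vec v_{j,\ell}\}$, $\mathcal W_{M,N}:=\operatorname{conv}\{\vec w_{j,\ell}\}$ (over all $j,\ell$). Two polytopes $\mathcal P,\mathcal Q$ are combinatorially equivalent if there is a bijection $\vec p^{(i)}\mapsto\vec q^{(i)}$ between their vertex sets such that for every index set $I$, $\operatorname{conv}\{\vec p^{(i)}:i\in I\}$ is a face of $\mathcal P$ iff $\operatorname{conv}\{\vec q^{(i)}:i\in I\}$ is a face of $\mathcal Q$. Two combinatorially equivalent polytopes are normally equivalent if the facet normals of corresponding facets coincide.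
   Formalization: The polygons $\mathcal V_{M,N}$ and $\mathcal W_{M,N}$, their faces and facet normals are taken in ℚ² rather than ℝ², with rational convex weights and rational supporting inequalities. -}

module Defs where

open import Data.Nat as ℕ using (ℕ; zero; suc; _∸_)
open import Data.Integer using (+_)
open import Data.Rational using (ℚ; _/_; 0ℚ; 1ℚ; _+_; _*_; _-_; _≤_)
open import Data.Product using (Σ; Σ-syntax; ∃; ∃-syntax; _×_; _,_; proj₁)
open import Data.List using (List; []; _∷_; length; lookup; map; concatMap; upTo)
open import Data.Fin using (Fin)
open import Data.Unit using (⊤)
open import Data.Empty using (⊥)
open import Relation.Nullary using (¬_)
open import Relation.Binary.PropositionalEquality using (_≡_; _≢_)
open import Function.Bundles using (_⇔_)

-- Points of ℚ² (all points in the paper have rational coordinates)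

Pt : Set
Pt = ℚ × ℚ

_⊕_ : Pt → Pt → Pt
(a , b) ⊕ (c , d) = (a + c , b + d)

_⊙_ : ℚ → Pt → Pt
t ⊙ (a , b) = (t * a , t * b)

0Pt : Pt
0Pt = (0ℚ , 0ℚ)

_·_ : Pt → Pt → ℚ
(a , b) · (c , d) = a * c + b * d

sumℚ : ∀ {n} → (Fin n → ℚ) → ℚ
sumℚ {zero}  f = 0ℚ
sumℚ {suc n} f = f Fin.zero + sumℚ (λ i → f (Fin.suc i))

sumPt : ∀ {n} → (Fin n → Pt) → Pt
sumPt {zero}  f = 0Pt
sumPt {suc n} f = f Fin.zero ⊕ sumPt (λ i → f (Fin.suc i))

PtSet : Set₁
PtSet = Pt → Set

_≐_ : PtSet → PtSet → Set
S ≐ T = ∀ x → S x ⇔ T x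

conv : List Pt → PtSet
conv L x =
  Σ[ w ∈ (Fin (length L) → ℚ) ]
    ((∀ i → 0ℚ ≤ w i) ×
     (sumℚ w ≡ 1ℚ) ×
     (sumPt (λ i → w i ⊙ lookup L i) ≡ x))

-- The inequality c·x ≤ b is valid for conv G and F is the set of points of
-- conv G where it is tight.  (c = 0, b = 0 gives the polytope itself;
-- c = 0, b = 1 gives the empty face.)

Defines : List Pt → Pt → ℚ → PtSet → Set
Defines G c b F =
  (∀ x → conv G x → (c · x) ≤ b) ×
  (F ≐ (λ x → conv G x × (c · x ≡ b)))

IsFace : List Pt → PtSet → Set
IsFace G F = ∃[ c ] ∃[ b ] Defines G c b F

IsVertex : List Pt → Pt → Set
IsVertex G x = IsFace G (λ y → y ≡ x)

Vtx : List Pt → Set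
Vtx G = Σ Pt (IsVertex G)

-- Affine dimension in ℚ².  DimGe k S  means  dim (aff S) ≥ k - 1.

det : Pt → Pt → ℚ
det (a , b) (c , d) = a * d - b * c

_⊖_ : Pt → Pt → Pt
(a , b) ⊖ (c , d) = (a - c , b - d)

DimGe : ℕ → PtSet → Set
DimGe 0 S = ⊤
DimGe 1 S = ∃[ x ] S x
DimGe 2 S = ∃[ x ] ∃[ y ] (S x × S y × x ≢ y)
DimGe 3 S = ∃[ x ] ∃[ y ] ∃[ z ] (S x × S y × S z × det (y ⊖ x) (z ⊖ x) ≢ 0ℚ)
DimGe (suc (suc (suc (suc _)))) S = ⊥

IsFacet : List Pt → PtSet → Set
IsFacet G F =
  IsFace G F ×
  ∃[ k ] (DimGe (suc k) (conv G) × ¬ DimGe (suc (suc k)) (conv G) ×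
          DimGe k F × ¬ DimGe (suc k) F)

vconv : ∀ G → List (Vtx G) → PtSet
vconv G L = conv (map proj₁ L)

record CombEquiv (G H : List Pt) : Set where
  field
    to      : Vtx G → Vtx H
    from    : Vtx H → Vtx G
    from∘to : ∀ v → proj₁ (from (to v)) ≡ proj₁ v
    to∘from : ∀ w → proj₁ (to (from w)) ≡ proj₁ w
    faces   : ∀ (I : List (Vtx G)) →
              IsFace G (vconv G I) ⇔ IsFace H (vconv H (map to I))

NormallyEquivalent : List Pt → List Pt → Set
NormallyEquivalent G H =
  Σ[ e ∈ CombEquiv G H ]
    (∀ (I : List (Vtx G)) → IsFacet G (vconv G I) →
       ∀ c b → Defines G c b (vconv G I) →
       ∃[ b' ] Defines H c b' (vconv H (map (CombEquiv.to e) I)))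

-- p / q as a rational (q is MN-1 ≥ 7 in the lemma, so the zero case is unused)
frac : ℕ → ℕ → ℚ
frac p zero    = 0ℚ
frac p (suc q) = + p / suc q

h : ℚ → Pt
h x = (x , x * x - x)

vPt : ℕ → ℕ → ℕ → ℕ → Pt
vPt M N j ℓ = h (frac (2 ℕ.* M ℕ.* (j ℕ.+ ℓ) ∸ ℓ) (M ℕ.* N ∸ 1))

wPt : ℕ → ℕ → ℕ → ℕ → Pt
wPt M N j ℓ = h (frac (M ℕ.* (2 ℕ.* j ℕ.+ 1) ∸ (1 ∸ ℓ)) (M ℕ.* N ∸ 1))

Vgens : ℕ → ℕ → List Pt
Vgens M N = concatMap (λ j → vPt M N j 0 ∷ vPt M N j 1 ∷ []) (upTo (N ℕ./ 2))

Wgens : ℕ → ℕ → List Pt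
Wgens M N = concatMap (λ j → wPt M N j 0 ∷ wPt M N j 1 ∷ []) (upTo (N ℕ./ 2))

{-# OPTIONS --safe #-}
-- All points lie on the parabola h, so each polygon is in convex position and its vertices are
-- its generators, ordered by x-coordinate.  The chord of c · h between x and y has slope
-- c₂ (x + y) + c₁ − c₂, an affine function of x + y; hence whether a vertex maximizes c is decided
-- by the signs of this function at the sums of x-coordinates along its two incident edges
-- (including the edge that closes the polygon).  Sorted, the x-coordinates of V and W are
-- 0, 2M − 1, 2M, 4M − 1, 4M, … and M − 1, M, 3M − 1, 3M, … (over MN − 1): two zigzags with the same
-- step and the same first pair sum, so all these edge sums agree.  The i-th vertices of V and W
-- therefore maximize the same linear functionals, and matching them preserves faces and normals.
module Submission where

open import Defs
open import Data.Nat using (ℕ; _≤_)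
import Data.Nat as ℕ
import Data.Nat.Properties as ℕP
open import Data.Nat.DivMod using (m≡m%n+[m/n]*n; m%n<n; /-monoˡ-≤)
import Data.Nat.Tactic.RingSolver as ℕ-Solver
open import Data.Nat.Divisibility using (_∣_)

open import Data.Empty using (⊥-elim)
open import Data.Fin as Fin using (Fin)
open import Data.List using (List; []; _∷_; length; lookup; map; filter; concatMap; upTo)
open import Data.List.Relation.Binary.Subset.Propositional using (_⊆_)
open import Data.List.Membership.Propositional using (_∈_; find; lose)
open import Data.List.Membership.Propositional.Properties
  using (∈-lookup; ∈-filter⁺; ∈-filter⁻; ∈-map⁺; ∈-map⁻; ∈-concatMap⁺; ∈-concatMap⁻;
         ∈-upTo⁺; ∈-upTo⁻)
open import Data.List.Relation.Unary.Any as Any using (here; there)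
open import Data.List.Relation.Unary.Any.Properties using (lookup-index)
open import Data.Product using (∃-syntax; _×_; _,_; proj₁; proj₂; swap)
open import Data.Sum using (_⊎_; inj₁; inj₂; map₂)
import Data.Integer as ℤ
import Data.Integer.Properties as ℤP
import Data.Integer.Tactic.RingSolver as ℤ-Solver
import Data.Rational.Unnormalised as ℚᵘ
import Data.Rational.Unnormalised.Properties as ℚᵘP
open import Data.Rational as ℚ
  using (ℚ; 0ℚ; 1ℚ; _+_; _*_; _-_; -_)
  renaming (_≤_ to _≤ℚ_; _<_ to _<ℚ_)
import Data.Rational.Properties as ℚP
open import Relation.Binary.Bundles using (DecTotalOrder)
open import Relation.Binary.Definitions using (tri<; tri≈; tri>)
import Data.List.Extrema (DecTotalOrder.totalOrder ℚP.≤-decTotalOrder) as Extrema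
open import Function using (_∘_)
open import Function.Bundles using (_⇔_; mk⇔; Equivalence)
open import Level using (0ℓ)
open import Relation.Binary.PropositionalEquality
open import Relation.Nullary using (¬_; Dec; yes; no)
open import Relation.Nullary.Decidable using (dec⇒maybe)
import Tactic.RingSolver.Core.AlmostCommutativeRing as ACR
open import Tactic.RingSolver using (solve-∀)

open import Algebra.Bundles using (Ring)
open import Algebra.Properties.Group ℚP.+-0-group
  using (identityʳ-unique; x∙y⁻¹≈ε⇒x≈y; x≈y⇒x∙y⁻¹≈ε)
open import Algebra.Properties.Semiring.Sum (Ring.semiring ℚP.+-*-ring)
  using (sum; sum-cong-≗; sum-replicate-zero; ∑-distrib-+; ∑-comm; *-distribˡ-sum)

open ≡-Reasoning

ℚ-ring : ACR.AlmostCommutativeRing 0ℓ 0ℓ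
ℚ-ring = ACR.fromCommutativeRing ℚP.+-*-commutativeRing (λ x → dec⇒maybe (0ℚ ℚP.≟ x))

p≤q⇒0≤q-p : ∀ {p q} → p ≤ℚ q → 0ℚ ≤ℚ q - p
p≤q⇒0≤q-p {p} {q} p≤q = subst (_≤ℚ q - p) (ℚP.+-inverseʳ p) (ℚP.+-monoˡ-≤ (- p) p≤q)

q-p+p≡q : ∀ p q → q - p + p ≡ q
q-p+p≡q = solve-∀ ℚ-ring

0≤q-p⇒p≤q : ∀ {p q} → 0ℚ ≤ℚ q - p → p ≤ℚ q
0≤q-p⇒p≤q {p} {q} 0≤q-p = subst₂ _≤ℚ_ (ℚP.+-identityˡ p) (q-p+p≡q p q) (ℚP.+-monoˡ-≤ p 0≤q-p)

p≤p+q : ∀ {p q} → 0ℚ ≤ℚ q → p ≤ℚ p + q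
p≤p+q {p} {q} 0≤q = subst (_≤ℚ p + q) (ℚP.+-identityʳ p) (ℚP.+-monoʳ-≤ p 0≤q)

q≤p+q : ∀ {p q} → 0ℚ ≤ℚ p → q ≤ℚ p + q
q≤p+q {p} {q} 0≤p = subst (_≤ℚ p + q) (ℚP.+-identityˡ q) (ℚP.+-monoˡ-≤ q 0≤p)

p<q⇒0<q-p : ∀ {p q} → p <ℚ q → 0ℚ <ℚ q - p
p<q⇒0<q-p {p} {q} p<q = subst (_<ℚ q - p) (ℚP.+-inverseʳ p) (ℚP.+-monoˡ-< (- p) p<q)

*-nonNeg : ∀ {p q} → 0ℚ ≤ℚ p → 0ℚ ≤ℚ q → 0ℚ ≤ℚ p * q
*-nonNeg {p} {q} 0≤p 0≤q =
  ℚP.nonNegative⁻¹ _ {{ℚP.nonNeg*nonNeg⇒nonNeg p {{ℚ.nonNegative 0≤p}} q {{ℚ.nonNegative 0≤q}}}}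

0≤d*s⇔0≤s : ∀ {d s} → 0ℚ <ℚ d → 0ℚ ≤ℚ d * s ⇔ 0ℚ ≤ℚ s
0≤d*s⇔0≤s {d} {s} 0<d = mk⇔
  (λ 0≤ds → ℚP.*-cancelˡ-≤-pos d {{ℚ.positive 0<d}} (subst (_≤ℚ d * s) (sym (ℚP.*-zeroʳ d)) 0≤ds))
  (*-nonNeg (ℚP.<⇒≤ 0<d))

p*q≡0⇒p≡0 : ∀ {p q} → q ≢ 0ℚ → p * q ≡ 0ℚ → p ≡ 0ℚ
p*q≡0⇒p≡0 {p} {q} q≢0 pq≡0 = begin
  p                  ≡⟨ sym (ℚP.*-identityʳ p) ⟩
  p * 1ℚ             ≡⟨ cong (p *_) (sym (ℚP.*-inverseʳ q)) ⟩
  p * (q * ℚ.1/ q)   ≡⟨ sym (ℚP.*-assoc p q _) ⟩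
  p * q * ℚ.1/ q     ≡⟨ cong (_* ℚ.1/ q) pq≡0 ⟩
  0ℚ * ℚ.1/ q        ≡⟨ ℚP.*-zeroˡ (ℚ.1/ q) ⟩
  0ℚ                 ∎
  where instance _ = ℚ.≢-nonZero q≢0

square-nonNeg : ∀ d → 0ℚ ≤ℚ d * d
square-nonNeg d with ℚP.≤-total 0ℚ d
... | inj₁ 0≤d = *-nonNeg 0≤d 0≤d
... | inj₂ d≤0 = -- despite its name, nonPos*nonPos⇒nonPos concludes NonNegative
  ℚP.nonNegative⁻¹ _ {{ℚP.nonPos*nonPos⇒nonPos d {{ℚ.nonPositive d≤0}} d {{ℚ.nonPositive d≤0}}}}

square≡0⇒≡0 : ∀ {d} → d * d ≡ 0ℚ → d ≡ 0ℚ
square≡0⇒≡0 {d} dd≡0 with d ℚP.≟ 0ℚ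
... | yes d≡0 = d≡0
... | no  d≢0 = p*q≡0⇒p≡0 d≢0 dd≡0

sumℚ≡sum : ∀ {n} (f : Fin n → ℚ) → sumℚ f ≡ sum f
sumℚ≡sum {ℕ.zero}  f = refl
sumℚ≡sum {ℕ.suc n} f = cong (f Fin.zero +_) (sumℚ≡sum (f ∘ Fin.suc))

sumℚ-cong : ∀ {n} {f g : Fin n → ℚ} → (∀ i → f i ≡ g i) → sumℚ f ≡ sumℚ g
sumℚ-cong {f = f} {g} f≗g = begin
  sumℚ f  ≡⟨ sumℚ≡sum f ⟩
  sum f   ≡⟨ sum-cong-≗ f≗g ⟩
  sum g   ≡⟨ sumℚ≡sum g ⟨
  sumℚ g  ∎

sumℚ-zero : ∀ n → sumℚ {n} (λ _ → 0ℚ) ≡ 0ℚ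
sumℚ-zero n = trans (sumℚ≡sum {n} (λ _ → 0ℚ)) (sum-replicate-zero n)

sumℚ-+ : ∀ {n} (f g : Fin n → ℚ) → sumℚ (λ i → f i + g i) ≡ sumℚ f + sumℚ g
sumℚ-+ f g = begin
  sumℚ (λ i → f i + g i)  ≡⟨ sumℚ≡sum (λ i → f i + g i) ⟩
  sum (λ i → f i + g i)   ≡⟨ ∑-distrib-+ f g ⟩
  sum f + sum g           ≡⟨ cong₂ _+_ (sumℚ≡sum f) (sumℚ≡sum g) ⟨
  sumℚ f + sumℚ g         ∎

sumℚ-*ˡ : ∀ {n} a (f : Fin n → ℚ) → sumℚ (λ i → a * f i) ≡ a * sumℚ f
sumℚ-*ˡ a f = begin
  sumℚ (λ i → a * f i)  ≡⟨ sumℚ≡sum (λ i → a * f i) ⟩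
  sum (λ i → a * f i)   ≡⟨ *-distribˡ-sum a f ⟨
  a * sum f             ≡⟨ cong (a *_) (sumℚ≡sum f) ⟨
  a * sumℚ f            ∎

sumℚ-*ʳ : ∀ {n} a (f : Fin n → ℚ) → sumℚ (λ i → f i * a) ≡ sumℚ f * a
sumℚ-*ʳ a f = begin
  sumℚ (λ i → f i * a)  ≡⟨ sumℚ-cong (λ i → ℚP.*-comm (f i) a) ⟩
  sumℚ (λ i → a * f i)  ≡⟨ sumℚ-*ˡ a f ⟩
  a * sumℚ f            ≡⟨ ℚP.*-comm a _ ⟩
  sumℚ f * a            ∎

sumℚ-comm : ∀ {m n} (f : Fin m → Fin n → ℚ) →
  sumℚ (λ i → sumℚ (λ j → f i j)) ≡ sumℚ (λ j → sumℚ (λ i → f i j))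
sumℚ-comm f = begin
  sumℚ (λ i → sumℚ (λ j → f i j))  ≡⟨ sumℚ-cong (λ i → sumℚ≡sum (f i)) ⟩
  sumℚ (λ i → sum (λ j → f i j))   ≡⟨ sumℚ≡sum (λ i → sum (λ j → f i j)) ⟩
  sum (λ i → sum (λ j → f i j))    ≡⟨ ∑-comm f ⟩
  sum (λ j → sum (λ i → f i j))    ≡⟨ sumℚ≡sum (λ j → sum (λ i → f i j)) ⟨
  sumℚ (λ j → sum (λ i → f i j))   ≡⟨ sumℚ-cong (λ j → sumℚ≡sum (λ i → f i j)) ⟨
  sumℚ (λ j → sumℚ (λ i → f i j))  ∎

sumℚ-mono : ∀ {n} {f g : Fin n → ℚ} → (∀ i → f i ≤ℚ g i) → sumℚ f ≤ℚ sumℚ g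
sumℚ-mono {ℕ.zero}  f≤g = ℚP.≤-refl
sumℚ-mono {ℕ.suc n} f≤g = ℚP.+-mono-≤ (f≤g Fin.zero) (sumℚ-mono (f≤g ∘ Fin.suc))

sumℚ-nonNeg : ∀ {n} {f : Fin n → ℚ} → (∀ i → 0ℚ ≤ℚ f i) → 0ℚ ≤ℚ sumℚ f
sumℚ-nonNeg {n} {f} 0≤f = subst (_≤ℚ sumℚ f) (sumℚ-zero n) (sumℚ-mono 0≤f)

term≤sumℚ : ∀ {n} {f : Fin n → ℚ} → (∀ i → 0ℚ ≤ℚ f i) → ∀ i → f i ≤ℚ sumℚ f
term≤sumℚ {f = f} 0≤f Fin.zero = p≤p+q (sumℚ-nonNeg (0≤f ∘ Fin.suc))
term≤sumℚ {f = f} 0≤f (Fin.suc i) = ℚP.≤-trans (term≤sumℚ (0≤f ∘ Fin.suc) i) (q≤p+q (0≤f Fin.zero))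

pointMass : ∀ {n} → Fin n → ℚ → Fin n → ℚ
pointMass Fin.zero    a Fin.zero    = a
pointMass Fin.zero    a (Fin.suc k) = 0ℚ
pointMass (Fin.suc j) a Fin.zero    = 0ℚ
pointMass (Fin.suc j) a (Fin.suc k) = pointMass j a k

pointMass-nonNeg : ∀ {n} (j k : Fin n) {a} → 0ℚ ≤ℚ a → 0ℚ ≤ℚ pointMass j a k
pointMass-nonNeg Fin.zero    Fin.zero    0≤a = 0≤a
pointMass-nonNeg Fin.zero    (Fin.suc k) 0≤a = ℚP.≤-refl
pointMass-nonNeg (Fin.suc j) Fin.zero    0≤a = ℚP.≤-refl
pointMass-nonNeg (Fin.suc j) (Fin.suc k) 0≤a = pointMass-nonNeg j k 0≤a

sumℚ-*pointMass : ∀ {n} (j : Fin n) a (φ : Fin n → ℚ) → sumℚ (λ k → pointMass j a k * φ k) ≡ a * φ j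
sumℚ-*pointMass {ℕ.suc n} Fin.zero a φ = begin
  a * φ₀ + sumℚ (λ k → 0ℚ * φ (Fin.suc k))
    ≡⟨ cong (a * φ₀ +_) (trans (sumℚ-cong (ℚP.*-zeroˡ ∘ φ ∘ Fin.suc)) (sumℚ-zero n)) ⟩
  a * φ₀ + 0ℚ  ≡⟨ ℚP.+-identityʳ (a * φ₀) ⟩
  a * φ₀       ∎
  where
  φ₀ : ℚ
  φ₀ = φ Fin.zero
sumℚ-*pointMass {ℕ.suc n} (Fin.suc j) a φ = begin
  0ℚ * φ Fin.zero + rest  ≡⟨ cong (_+ rest) (ℚP.*-zeroˡ (φ Fin.zero)) ⟩
  0ℚ + rest               ≡⟨ ℚP.+-identityˡ rest ⟩
  rest                    ≡⟨ sumℚ-*pointMass j a (φ ∘ Fin.suc) ⟩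
  a * φ (Fin.suc j)       ∎
  where
  rest : ℚ
  rest = sumℚ (λ k → pointMass j a k * φ (Fin.suc k))

convexCombination-const : ∀ {n} (w : Fin n → ℚ) → sumℚ w ≡ 1ℚ → ∀ b → sumℚ (λ i → w i * b) ≡ b
convexCombination-const w Σw≡1 b = begin
  sumℚ (λ i → w i * b)  ≡⟨ sumℚ-*ʳ b w ⟩
  sumℚ w * b            ≡⟨ cong (_* b) Σw≡1 ⟩
  1ℚ * b                ≡⟨ ℚP.*-identityˡ b ⟩
  b                     ∎

convexCombination-≤ : ∀ {n} {w a : Fin n → ℚ} {b} → (∀ i → 0ℚ ≤ℚ w i) → sumℚ w ≡ 1ℚ →
  (∀ i → a i ≤ℚ b) → sumℚ (λ i → w i * a i) ≤ℚ b
convexCombination-≤ {w = w} {a} {b} 0≤w Σw≡1 a≤b =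
  subst (sumℚ (λ i → w i * a i) ≤ℚ_) (convexCombination-const w Σw≡1 b)
    (sumℚ-mono (λ i → ℚP.*-monoˡ-≤-nonNeg (w i) {{ℚ.nonNegative (0≤w i)}} (a≤b i)))

convexCombination-≡ : ∀ {n} (w : Fin n → ℚ) {a : Fin n → ℚ} {b} → sumℚ w ≡ 1ℚ →
  (∀ i → a i ≡ b) → sumℚ (λ i → w i * a i) ≡ b
convexCombination-≡ w {b = b} Σw≡1 a≡b =
  trans (sumℚ-cong (λ i → cong (w i *_) (a≡b i))) (convexCombination-const w Σw≡1 b)

convexCombination-max : ∀ {n} {w a : Fin n → ℚ} {b} → (∀ i → 0ℚ ≤ℚ w i) → sumℚ w ≡ 1ℚ →
  (∀ i → a i ≤ℚ b) → sumℚ (λ i → w i * a i) ≡ b → ∀ i → w i ≡ 0ℚ ⊎ a i ≡ b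
convexCombination-max {n} {w} {a} {b} 0≤w Σw≡1 a≤b Σwa≡b i with a i ℚP.≟ b
... | yes aᵢ≡b = inj₂ aᵢ≡b
... | no  aᵢ≢b = inj₁ (p*q≡0⇒p≡0 (aᵢ≢b ∘ sym ∘ x∙y⁻¹≈ε⇒x≈y b (a i)) eᵢ≡0)
  where
  e : Fin n → ℚ
  e j = w j * (b - a j)
  0≤e : ∀ j → 0ℚ ≤ℚ e j
  0≤e j = *-nonNeg (0≤w j) (p≤q⇒0≤q-p (a≤b j))
  split : ∀ j → w j * a j + e j ≡ w j * b
  split j = lemma (w j) (a j) b
    where
    lemma : ∀ w a b → w * a + w * (b - a) ≡ w * b
    lemma = solve-∀ ℚ-ring
  Σe≡0 : sumℚ e ≡ 0ℚ
  Σe≡0 = identityʳ-unique b (sumℚ e) (begin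
    b + sumℚ e                         ≡⟨ cong (_+ sumℚ e) Σwa≡b ⟨
    sumℚ (λ j → w j * a j) + sumℚ e    ≡⟨ sumℚ-+ (λ j → w j * a j) e ⟨
    sumℚ (λ j → w j * a j + e j)       ≡⟨ sumℚ-cong split ⟩
    sumℚ (λ j → w j * b)               ≡⟨ convexCombination-const w Σw≡1 b ⟩
    b                                  ∎)
  eᵢ≡0 : e i ≡ 0ℚ
  eᵢ≡0 = ℚP.≤-antisym (subst (e i ≤ℚ_) Σe≡0 (term≤sumℚ 0≤e i)) (0≤e i)

-- Convex hulls

sumPt-split : ∀ {n} (f : Fin n → Pt) → sumPt f ≡ (sumℚ (proj₁ ∘ f) , sumℚ (proj₂ ∘ f))
sumPt-split {ℕ.zero}  f = refl
sumPt-split {ℕ.suc n} f rewrite sumPt-split (f ∘ Fin.suc) = refl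

·-⊙-⊕ : ∀ c a p q → c · ((a ⊙ p) ⊕ q) ≡ a * (c · p) + c · q
·-⊙-⊕ (c₁ , c₂) a (p₁ , p₂) (q₁ , q₂) = bilinear c₁ c₂ a p₁ p₂ q₁ q₂
  where
  bilinear : ∀ c₁ c₂ a p₁ p₂ q₁ q₂ →
    c₁ * (a * p₁ + q₁) + c₂ * (a * p₂ + q₂) ≡ a * (c₁ * p₁ + c₂ * p₂) + (c₁ * q₁ + c₂ * q₂)
  bilinear = solve-∀ ℚ-ring

·-0Pt : ∀ c → c · 0Pt ≡ 0ℚ
·-0Pt (c₁ , c₂) = lemma c₁ c₂
  where
  lemma : ∀ c₁ c₂ → c₁ * 0ℚ + c₂ * 0ℚ ≡ 0ℚ
  lemma = solve-∀ ℚ-ring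

·-sumPt : ∀ {n} c (w : Fin n → ℚ) (p : Fin n → Pt) →
  c · sumPt (λ i → w i ⊙ p i) ≡ sumℚ (λ i → w i * (c · p i))
·-sumPt {ℕ.zero}  c w p = ·-0Pt c
·-sumPt {ℕ.suc n} c w p = trans (·-⊙-⊕ c (w Fin.zero) (p Fin.zero) _)
  (cong (w Fin.zero * (c · p Fin.zero) +_) (·-sumPt c (w ∘ Fin.suc) (p ∘ Fin.suc)))

conv-[] : ∀ {x} → ¬ conv [] x
conv-[] (_ , _ , 0≡1 , _) = ℚP.1≢0 (sym 0≡1)

conv-[p] : ∀ {p x} → conv (p ∷ []) x → x ≡ p
conv-[p] {p} {x} (w , _ , Σw≡1 , Σwp≡x) = begin
  x                                          ≡⟨ Σwp≡x ⟨
  (w₀ * proj₁ p + 0ℚ , w₀ * proj₂ p + 0ℚ)    ≡⟨ cong₂ _,_ (coordinate proj₁) (coordinate proj₂) ⟩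
  p                                          ∎
  where
  w₀ : ℚ
  w₀ = w Fin.zero
  w₀≡1 : w₀ ≡ 1ℚ
  w₀≡1 = trans (sym (ℚP.+-identityʳ w₀)) Σw≡1
  coordinate : (π : Pt → ℚ) → w₀ * π p + 0ℚ ≡ π p
  coordinate π = trans (ℚP.+-identityʳ _) (trans (cong (_* π p) w₀≡1) (ℚP.*-identityˡ (π p)))

conv-·≤ : ∀ {L x b} c → (∀ {p} → p ∈ L → c · p ≤ℚ b) → conv L x → c · x ≤ℚ b
conv-·≤ {L} c L≤b (w , 0≤w , Σw≡1 , refl) =
  subst (_≤ℚ _) (sym (·-sumPt c w (lookup L))) (convexCombination-≤ 0≤w Σw≡1 (L≤b ∘ ∈-lookup {xs = L}))

conv-·≡ : ∀ {L x b} c → (∀ {p} → p ∈ L → c · p ≡ b) → conv L x → c · x ≡ b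
conv-·≡ {L} c L≡b (w , 0≤w , Σw≡1 , refl) =
  trans (·-sumPt c w (lookup L)) (convexCombination-≡ w Σw≡1 (L≡b ∘ ∈-lookup {xs = L}))

spread : ∀ {a p} (L' : List Pt) → a ≡ 0ℚ ⊎ p ∈ L' → Fin (length L') → ℚ
spread     L' (inj₁ _)    k = 0ℚ
spread {a} L' (inj₂ p∈L') k = pointMass (Any.index p∈L') a k

spread-nonNeg : ∀ {a p} {L' : List Pt} (s : a ≡ 0ℚ ⊎ p ∈ L') → 0ℚ ≤ℚ a →
  ∀ k → 0ℚ ≤ℚ spread L' s k
spread-nonNeg (inj₁ _)    0≤a k = ℚP.≤-refl
spread-nonNeg (inj₂ p∈L') 0≤a k = pointMass-nonNeg (Any.index p∈L') k 0≤a

sumℚ-*spread : ∀ {a p} {L' : List Pt} (s : a ≡ 0ℚ ⊎ p ∈ L') (φ : Pt → ℚ) →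
  sumℚ (λ k → spread L' s k * φ (lookup L' k)) ≡ a * φ p
sumℚ-*spread {p = p} {L'} (inj₁ refl) φ = begin
  sumℚ (λ k → 0ℚ * φ (lookup L' k))  ≡⟨ sumℚ-cong (λ k → ℚP.*-zeroˡ (φ (lookup L' k))) ⟩
  sumℚ {length L'} (λ _ → 0ℚ)        ≡⟨ sumℚ-zero (length L') ⟩
  0ℚ                                 ≡⟨ ℚP.*-zeroˡ (φ p) ⟨
  0ℚ * φ p                           ∎
sumℚ-*spread {a} {L' = L'} (inj₂ p∈L') φ = begin
  sumℚ (λ k → pointMass (Any.index p∈L') a k * φ (lookup L' k))
    ≡⟨ sumℚ-*pointMass (Any.index p∈L') a (φ ∘ lookup L') ⟩
  a * φ (lookup L' (Any.index p∈L'))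
    ≡⟨ cong (λ q → a * φ q) (lookup-index p∈L') ⟨
  a * φ _
    ∎

conv-reweight : ∀ {L L' x} (x∈ : conv L x) → (∀ i → proj₁ x∈ i ≡ 0ℚ ⊎ lookup L i ∈ L') → conv L' x
conv-reweight {L} {L'} {x} (w , 0≤w , Σw≡1 , Σwp≡x) s = W , 0≤W , ΣW≡1 , ΣWp≡x
  where
  W : Fin (length L') → ℚ
  W k = sumℚ (λ i → spread L' (s i) k)
  0≤W : ∀ k → 0ℚ ≤ℚ W k
  0≤W k = sumℚ-nonNeg (λ i → spread-nonNeg (s i) (0≤w i) k)
  moment : ∀ φ → sumℚ (λ k → W k * φ (lookup L' k)) ≡ sumℚ (λ i → w i * φ (lookup L i))
  moment φ = begin
    sumℚ (λ k → W k * φ (lookup L' k))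
      ≡⟨ sumℚ-cong (λ k → sym (sumℚ-*ʳ (φ (lookup L' k)) (λ i → spread L' (s i) k))) ⟩
    sumℚ (λ k → sumℚ (λ i → spread L' (s i) k * φ (lookup L' k)))
      ≡⟨ sumℚ-comm (λ i k → spread L' (s i) k * φ (lookup L' k)) ⟨
    sumℚ (λ i → sumℚ (λ k → spread L' (s i) k * φ (lookup L' k)))
      ≡⟨ sumℚ-cong (λ i → sumℚ-*spread (s i) φ) ⟩
    sumℚ (λ i → w i * φ (lookup L i))
      ∎
  ΣW≡1 : sumℚ W ≡ 1ℚ
  ΣW≡1 = begin
    sumℚ W                 ≡⟨ sumℚ-cong (λ k → sym (ℚP.*-identityʳ (W k))) ⟩
    sumℚ (λ k → W k * 1ℚ)  ≡⟨ moment (λ _ → 1ℚ) ⟩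
    sumℚ (λ i → w i * 1ℚ)  ≡⟨ sumℚ-cong (λ i → ℚP.*-identityʳ (w i)) ⟩
    sumℚ w                 ≡⟨ Σw≡1 ⟩
    1ℚ                     ∎
  ΣWp≡x : sumPt (λ k → W k ⊙ lookup L' k) ≡ x
  ΣWp≡x = begin
    sumPt (λ k → W k ⊙ lookup L' k)  ≡⟨ sumPt-split (λ k → W k ⊙ lookup L' k) ⟩
    _                                ≡⟨ cong₂ _,_ (moment proj₁) (moment proj₂) ⟩
    _                                ≡⟨ sumPt-split (λ i → w i ⊙ lookup L i) ⟨
    sumPt (λ i → w i ⊙ lookup L i)   ≡⟨ Σwp≡x ⟩
    x                                ∎

conv-⊆ : ∀ {L L' x} → L ⊆ L' → conv L x → conv L' x
conv-⊆ {L} L⊆L' x∈ = conv-reweight {L} x∈ (λ i → inj₂ (L⊆L' (∈-lookup {xs = L} i)))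

∈⇒conv : ∀ {L p} → p ∈ L → conv L p
∈⇒conv {L} {p} p∈L = conv-⊆ [p]⊆L p∈[p]
  where
  [p]⊆L : p ∷ [] ⊆ L
  [p]⊆L (here refl) = p∈L
  p∈[p] : conv (p ∷ []) p
  p∈[p] = (λ _ → 1ℚ) , (λ _ → ℚP.nonNegative⁻¹ 1ℚ) , refl , cong₂ _,_ (unit (proj₁ p)) (unit (proj₂ p))
    where
    unit : ∀ a → 1ℚ * a + 0ℚ ≡ a
    unit a = trans (ℚP.+-identityʳ (1ℚ * a)) (ℚP.*-identityˡ a)

conv-face : ∀ {L L' x b} c → (∀ {p} → p ∈ L → c · p ≤ℚ b) →
  (∀ {p} → p ∈ L → c · p ≡ b → p ∈ L') → conv L x → c · x ≡ b → conv L' x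
conv-face {L} {b = b} c L≤b tight∈L' x∈@(w , 0≤w , Σw≡1 , Σwp≡x) cx≡b =
  conv-reweight {L} x∈ (λ i → map₂ (tight∈L' (∈-lookup {xs = L} i)) (zero-or-tight i))
  where
  Σwa≡b : sumℚ (λ i → w i * (c · lookup L i)) ≡ b
  Σwa≡b = trans (sym (·-sumPt c w (lookup L))) (trans (cong (c ·_) Σwp≡x) cx≡b)
  zero-or-tight : ∀ i → w i ≡ 0ℚ ⊎ c · lookup L i ≡ b
  zero-or-tight = convexCombination-max 0≤w Σw≡1 (L≤b ∘ ∈-lookup {xs = L}) Σwa≡b

conv-nonEmpty : ∀ {L x} → conv L x → ∃[ p ] p ∈ L
conv-nonEmpty {[]}    x∈[] = ⊥-elim (conv-[] x∈[])
conv-nonEmpty {p ∷ L} _    = p , here refl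

conv-attains : ∀ {L x b} c → (∀ {p} → p ∈ L → c · p ≤ℚ b) → conv L x → c · x ≡ b →
  ∃[ p ] p ∈ L × c · p ≡ b
conv-attains {L} {b = b} c L≤b x∈ cx≡b =
  let p , p∈tight = conv-nonEmpty {tight} (conv-face c L≤b (∈-filter⁺ tight?) x∈ cx≡b)
  in  p , ∈-filter⁻ tight? p∈tight
  where
  tight? : ∀ p → Dec (c · p ≡ b)
  tight? p = c · p ℚP.≟ b
  tight : List Pt
  tight = filter tight? L

-- Faces of a polygon whose generators are all exposed

Maximizes : List Pt → Pt → Pt → Set
Maximizes L c p = ∀ {q} → q ∈ L → c · q ≤ℚ c · p

StrictlyMaximizes : List Pt → Pt → Pt → Set
StrictlyMaximizes L c p = Maximizes L c p × (∀ {q} → q ∈ L → c · q ≡ c · p → q ≡ p)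

InConvexPosition : List Pt → Set
InConvexPosition L = ∀ {p} → p ∈ L → ∃[ c ] StrictlyMaximizes L c p

Argmax : List Pt → Pt → List Pt → Set
Argmax L c K = (∀ {p} → p ∈ K → Maximizes L c p) × (∀ {q} → q ∈ L → Maximizes L c q → q ∈ K)

valid⇒generators≤ : ∀ {L b} c → (∀ x → conv L x → c · x ≤ℚ b) → ∀ {p} → p ∈ L → c · p ≤ℚ b
valid⇒generators≤ c valid p∈L = valid _ (∈⇒conv p∈L)

conv-exposed⇒∈ : ∀ {L K q} → InConvexPosition L → K ⊆ L → q ∈ L → conv K q → q ∈ K
conv-exposed⇒∈ convex K⊆L q∈L q∈convK =
  let c , q-max , q-unique = convex q∈L
      p , p∈K , cp≡cq = conv-attains c (q-max ∘ K⊆L) q∈convK refl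
  in  subst (_∈ _) (q-unique (K⊆L p∈K) cp≡cq) p∈K

vertex⇒∈ : ∀ {L x} → IsVertex L x → x ∈ L
vertex⇒∈ {L} {x} (c , b , valid , face≐) =
  let x∈L , cx≡b  = Equivalence.to (face≐ x) refl
      p , p∈L , cp≡b = conv-attains c (valid⇒generators≤ c valid) x∈L cx≡b
  in  subst (_∈ L) (Equivalence.from (face≐ p) (∈⇒conv p∈L , cp≡b)) p∈L

∈⇒vertex : ∀ {L p} → InConvexPosition L → p ∈ L → IsVertex L p
∈⇒vertex {L} {p} convex p∈L =
  c , c · p , (λ x → conv-·≤ c p-max) , λ y → mk⇔ (to y) (from y)
  where
  c : Pt
  c = proj₁ (convex p∈L)
  p-max : Maximizes L c p
  p-max = proj₁ (proj₂ (convex p∈L))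
  p-unique : ∀ {q} → q ∈ L → c · q ≡ c · p → q ≡ p
  p-unique = proj₂ (proj₂ (convex p∈L))
  to : ∀ y → y ≡ p → conv L y × c · y ≡ c · p
  to y refl = ∈⇒conv p∈L , refl
  from : ∀ y → conv L y × c · y ≡ c · p → y ≡ p
  from y (y∈ , cy≡cp) =
    conv-[p] (conv-face {L' = p ∷ []} c p-max (λ q∈L cq≡cp → here (p-unique q∈L cq≡cp)) y∈ cy≡cp)

defines⇒argmax : ∀ {L p K c b} → InConvexPosition L → p ∷ K ⊆ L →
  Defines L c b (conv (p ∷ K)) → Argmax L c (p ∷ K)
defines⇒argmax {L} {p} {K} {c} {b} convex K⊆L (valid , face≐) = maximizes , closed
  where
  on-face : ∀ {q} → q ∈ p ∷ K → c · q ≡ b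
  on-face {q} q∈K = proj₂ (Equivalence.to (face≐ q) (∈⇒conv q∈K))
  maximizes : ∀ {q} → q ∈ p ∷ K → Maximizes L c q
  maximizes q∈K r∈L = subst (_ ≤ℚ_) (sym (on-face q∈K)) (valid⇒generators≤ c valid r∈L)
  closed : ∀ {q} → q ∈ L → Maximizes L c q → q ∈ p ∷ K
  closed {q} q∈L q-max =
    conv-exposed⇒∈ convex K⊆L q∈L (Equivalence.from (face≐ q) (∈⇒conv q∈L , cq≡b))
    where
    cq≡b : c · q ≡ b
    cq≡b = ℚP.≤-antisym (valid⇒generators≤ c valid q∈L)
             (subst (_≤ℚ c · q) (on-face (here refl)) (q-max (K⊆L (here refl))))

argmax⇒defines : ∀ {L p K c} → p ∷ K ⊆ L → Argmax L c (p ∷ K) → Defines L c (c · p) (conv (p ∷ K))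
argmax⇒defines {L} {p} {K} {c} K⊆L (maximizes , closed) =
  (λ x → conv-·≤ c p-max) , λ x → mk⇔ (to x) (from x)
  where
  p-max : Maximizes L c p
  p-max = maximizes (here refl)
  level : ∀ {q} → q ∈ p ∷ K → c · q ≡ c · p
  level q∈K = ℚP.≤-antisym (p-max (K⊆L q∈K)) (maximizes q∈K (K⊆L (here refl)))
  to : ∀ x → conv (p ∷ K) x → conv L x × c · x ≡ c · p
  to x x∈ = conv-⊆ K⊆L x∈ , conv-·≡ c level x∈
  from : ∀ x → conv L x × c · x ≡ c · p → conv (p ∷ K) x
  from x (x∈ , cx≡cp) =
    conv-face c p-max (λ q∈L cq≡cp → closed q∈L (subst (_ ≤ℚ_) (sym cq≡cp) ∘ p-max)) x∈ cx≡cp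

defines-[] : ∀ L c → ∃[ b ] Defines L c b (conv [])
defines-[] L c =
  b , (λ x x∈ → ℚP.<⇒≤ (below x∈)) ,
  λ x → mk⇔ (⊥-elim ∘ conv-[]) (λ (x∈ , cx≡b) → ⊥-elim (ℚP.<⇒≢ (below x∈) cx≡b))
  where
  m b : ℚ
  m = Extrema.max 0ℚ (map (c ·_) L)
  b = m + 1ℚ
  L≤m : ∀ {p} → p ∈ L → c · p ≤ℚ m
  L≤m p∈L = Extrema.v≤max⁺ 0ℚ (map (c ·_) L) (inj₂ (Any.map ℚP.≤-reflexive (∈-map⁺ (c ·_) p∈L)))
  m<b : m <ℚ b
  m<b = subst (_<ℚ b) (ℚP.+-identityʳ m) (ℚP.+-monoʳ-< m (ℚP.positive⁻¹ 1ℚ))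
  below : ∀ {x} → conv L x → c · x <ℚ b
  below x∈ = ℚP.≤-<-trans (conv-·≤ c L≤m x∈) m<b

-- Polygons whose generators maximize the same linear functionals

record ArgmaxCorrespondence (G H : List Pt) : Set₁ where
  field
    _∼_        : Pt → Pt → Set
    ∼-∈ˡ       : ∀ {p q} → p ∼ q → p ∈ G
    ∼-∈ʳ       : ∀ {p q} → p ∼ q → q ∈ H
    ∼-totalˡ   : ∀ {p} → p ∈ G → ∃[ q ] p ∼ q
    ∼-totalʳ   : ∀ {q} → q ∈ H → ∃[ p ] p ∼ q
    maximizes⇒ : ∀ {p q} c → p ∼ q → Maximizes G c p → Maximizes H c q
    maximizes⇐ : ∀ {p q} c → p ∼ q → Maximizes H c q → Maximizes G c p
    convexˡ    : InConvexPosition G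
    convexʳ    : InConvexPosition H

flipCorrespondence : ∀ {G H} → ArgmaxCorrespondence G H → ArgmaxCorrespondence H G
flipCorrespondence C = record
  { _∼_        = λ q p → p ∼ q
  ; ∼-∈ˡ       = ∼-∈ʳ
  ; ∼-∈ʳ       = ∼-∈ˡ
  ; ∼-totalˡ   = ∼-totalʳ
  ; ∼-totalʳ   = ∼-totalˡ
  ; maximizes⇒ = maximizes⇐
  ; maximizes⇐ = maximizes⇒
  ; convexˡ    = convexʳ
  ; convexʳ    = convexˡ
  }
  where open ArgmaxCorrespondence C

module Correspondence {G H : List Pt} (C : ArgmaxCorrespondence G H) where
  open ArgmaxCorrespondence C

  ∼-functional : ∀ {p q q'} → p ∼ q → p ∼ q' → q' ≡ q
  ∼-functional r r' =
    let c , q-max , q-unique = convexʳ (∼-∈ʳ r)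
        q'-max = maximizes⇒ c r' (maximizes⇐ c r q-max)
    in  q-unique (∼-∈ʳ r') (ℚP.≤-antisym (q-max (∼-∈ʳ r')) (q'-max (∼-∈ʳ r)))

  Matched : List Pt → List Pt → Set
  Matched K K' = (∀ {q} → q ∈ K' → ∃[ p ] p ∈ K × p ∼ q) ×
                 (∀ {p} → p ∈ K → ∃[ q ] q ∈ K' × p ∼ q)

  argmax-transfer : ∀ {c K K'} → Matched K K' → Argmax G c K → Argmax H c K'
  argmax-transfer {c} {K} {K'} (K'→K , K→K') (maximizes , closed) = maximizes' , closed'
    where
    maximizes' : ∀ {q} → q ∈ K' → Maximizes H c q
    maximizes' q∈K' = let p , p∈K , r = K'→K q∈K' in maximizes⇒ c r (maximizes p∈K)
    closed' : ∀ {q} → q ∈ H → Maximizes H c q → q ∈ K'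
    closed' q∈H q-max =
      let p , r = ∼-totalʳ q∈H
          q' , q'∈K' , r' = K→K' (closed (∼-∈ˡ r) (maximizes⇐ c r q-max))
      in  subst (_∈ K') (∼-functional r r') q'∈K'

  defines-transfer : ∀ {c b K K'} → K ⊆ G → K' ⊆ H → Matched K K' →
    Defines G c b (conv K) → ∃[ b' ] Defines H c b' (conv K')
  defines-transfer {c} {K' = []} _ _ _ _ = defines-[] H c
  defines-transfer {c} {K = []} {q ∷ K'} _ _ (K'→K , _) _ with () ← proj₁ (proj₂ (K'→K (here refl)))
  defines-transfer {c} {K = p ∷ K} {q ∷ K'} K⊆G K'⊆H matched d =
    c · q , argmax⇒defines {c = c} K'⊆H (argmax-transfer {c} matched (defines⇒argmax {c = c} convexˡ K⊆G d))

  toVertex : Vtx G → Vtx H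
  toVertex (x , x-vertex) =
    let q , r = ∼-totalˡ (vertex⇒∈ x-vertex) in q , ∈⇒vertex convexʳ (∼-∈ʳ r)

  toVertex-∼ : ∀ v → proj₁ v ∼ proj₁ (toVertex v)
  toVertex-∼ (x , x-vertex) = proj₂ (∼-totalˡ (vertex⇒∈ x-vertex))

  vertices⊆ : ∀ {L} (I : List (Vtx L)) → map proj₁ I ⊆ L
  vertices⊆ I x∈ with v , _ , refl ← ∈-map⁻ proj₁ x∈ = vertex⇒∈ (proj₂ v)

  matched : (I : List (Vtx G)) → Matched (map proj₁ I) (map proj₁ (map toVertex I))
  matched I = image⇒source , source⇒image
    where
    image⇒source : ∀ {q} → q ∈ map proj₁ (map toVertex I) → ∃[ p ] p ∈ map proj₁ I × p ∼ q
    image⇒source q∈ =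
      let u , u∈ , q≡u = ∈-map⁻ proj₁ q∈
          v , v∈I , u≡v = ∈-map⁻ toVertex u∈
      in  proj₁ v , ∈-map⁺ proj₁ v∈I ,
          subst (proj₁ v ∼_) (sym (trans q≡u (cong proj₁ u≡v))) (toVertex-∼ v)
    source⇒image : ∀ {p} → p ∈ map proj₁ I → ∃[ q ] q ∈ map proj₁ (map toVertex I) × p ∼ q
    source⇒image p∈ =
      let v , v∈I , p≡v = ∈-map⁻ proj₁ p∈
      in  proj₁ (toVertex v) , ∈-map⁺ proj₁ (∈-map⁺ toVertex v∈I) ,
          subst (_∼ proj₁ (toVertex v)) (sym p≡v) (toVertex-∼ v)

  face-transfer : (I : List (Vtx G)) → IsFace G (vconv G I) → IsFace H (vconv H (map toVertex I))
  face-transfer I (c , b , d) =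
    c , defines-transfer {c = c} {b = b} (vertices⊆ I) (vertices⊆ (map toVertex I)) (matched I) d

argmaxCorrespondence⇒normallyEquivalent : ∀ {G H} → ArgmaxCorrespondence G H → NormallyEquivalent G H
argmaxCorrespondence⇒normallyEquivalent {G} {H} C = combEquiv , λ I _ c b →
  defines-transfer {c = c} {b = b} (vertices⊆ I) (vertices⊆ (map toVertex I)) (matched I)
  where
  open ArgmaxCorrespondence C
  open Correspondence C
  module Flipped = Correspondence (flipCorrespondence C)
  combEquiv : CombEquiv G H
  combEquiv = record
    { to      = toVertex
    ; from    = Flipped.toVertex
    ; from∘to = λ v → Flipped.∼-functional (toVertex-∼ v) (Flipped.toVertex-∼ (toVertex v))
    ; to∘from = λ w → ∼-functional (Flipped.toVertex-∼ w) (toVertex-∼ (Flipped.toVertex w))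
    ; faces   = λ I → mk⇔ (face-transfer I) λ (c , b , d) →
        c , Flipped.defines-transfer {c = c} {b = b}
              (vertices⊆ (map toVertex I)) (vertices⊆ I) (swap (matched I)) d
    }

-- Points on the parabola h

parabola-inConvexPosition : ∀ {L} → (∀ {p} → p ∈ L → ∃[ x ] p ≡ h x) → InConvexPosition L
parabola-inConvexPosition {L} onParabola p∈L with x , refl ← onParabola p∈L =
  c , maximizes , unique
  where
  c : Pt
  c = (x + x - 1ℚ , - 1ℚ)
  gap : ∀ y → c · h x - c · h y ≡ (x - y) * (x - y)
  gap = lemma x
    where
    lemma : ∀ x y → ((x + x - 1ℚ) * x + - 1ℚ * (x * x - x)) - ((x + x - 1ℚ) * y + - 1ℚ * (y * y - y))
                    ≡ (x - y) * (x - y)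
    lemma = solve-∀ ℚ-ring
  maximizes : Maximizes L c (h x)
  maximizes q∈L with y , refl ← onParabola q∈L =
    0≤q-p⇒p≤q (subst (0ℚ ≤ℚ_) (sym (gap y)) (square-nonNeg (x - y)))
  unique : ∀ {q} → q ∈ L → c · q ≡ c · h x → q ≡ h x
  unique q∈L cq≡cp with y , refl ← onParabola q∈L =
    cong h (sym (x∙y⁻¹≈ε⇒x≈y x y (square≡0⇒≡0 (trans (sym (gap y)) (x≈y⇒x∙y⁻¹≈ε (sym cq≡cp))))))

slope : Pt → ℚ → ℚ
slope (c₁ , c₂) s = c₂ * s + (c₁ - c₂)

·h-chord : ∀ c x y → c · h y - c · h x ≡ (y - x) * slope c (x + y)
·h-chord (c₁ , c₂) = lemma c₁ c₂
  where
  lemma : ∀ c₁ c₂ x y → (c₁ * y + c₂ * (y * y - y)) - (c₁ * x + c₂ * (x * x - x))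
                        ≡ (y - x) * (c₂ * (x + y) + (c₁ - c₂))
  lemma = solve-∀ ℚ-ring

·h-chord⁻ : ∀ c x y → c · h x - c · h y ≡ (y - x) * (0ℚ - slope c (x + y))
·h-chord⁻ (c₁ , c₂) = lemma c₁ c₂
  where
  lemma : ∀ c₁ c₂ x y → (c₁ * x + c₂ * (x * x - x)) - (c₁ * y + c₂ * (y * y - y))
                        ≡ (y - x) * (0ℚ - (c₂ * (x + y) + (c₁ - c₂)))
  lemma = solve-∀ ℚ-ring

·h-≤⇔ : ∀ c {x y} → x <ℚ y → c · h x ≤ℚ c · h y ⇔ 0ℚ ≤ℚ slope c (x + y)
·h-≤⇔ c {x} {y} x<y = mk⇔
  (Equivalence.to positive ∘ subst (0ℚ ≤ℚ_) (·h-chord c x y) ∘ p≤q⇒0≤q-p)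
  (0≤q-p⇒p≤q ∘ subst (0ℚ ≤ℚ_) (sym (·h-chord c x y)) ∘ Equivalence.from positive)
  where
  positive : 0ℚ ≤ℚ (y - x) * slope c (x + y) ⇔ 0ℚ ≤ℚ slope c (x + y)
  positive = 0≤d*s⇔0≤s (p<q⇒0<q-p x<y)

·h-≥⇔ : ∀ c {x y} → x <ℚ y → c · h y ≤ℚ c · h x ⇔ slope c (x + y) ≤ℚ 0ℚ
·h-≥⇔ c {x} {y} x<y = mk⇔
  (0≤q-p⇒p≤q ∘ Equivalence.to positive ∘ subst (0ℚ ≤ℚ_) (·h-chord⁻ c x y) ∘ p≤q⇒0≤q-p)
  (0≤q-p⇒p≤q ∘ subst (0ℚ ≤ℚ_) (sym (·h-chord⁻ c x y)) ∘ Equivalence.from positive ∘ p≤q⇒0≤q-p)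
  where
  positive : 0ℚ ≤ℚ (y - x) * (0ℚ - slope c (x + y)) ⇔ 0ℚ ≤ℚ 0ℚ - slope c (x + y)
  positive = 0≤d*s⇔0≤s (p<q⇒0<q-p x<y)

slope-monotone : ∀ c {s s'} → 0ℚ ≤ℚ proj₂ c → s ≤ℚ s' → slope c s ≤ℚ slope c s'
slope-monotone (c₁ , c₂) 0≤c₂ s≤s' =
  ℚP.+-monoˡ-≤ (c₁ - c₂) (ℚP.*-monoˡ-≤-nonNeg c₂ {{ℚ.nonNegative 0≤c₂}} s≤s')

slope-antitone : ∀ c {s s'} → proj₂ c ≤ℚ 0ℚ → s ≤ℚ s' → slope c s' ≤ℚ slope c s
slope-antitone (c₁ , c₂) c₂≤0 s≤s' =
  ℚP.+-monoˡ-≤ (c₁ - c₂) (ℚP.*-monoˡ-≤-nonPos c₂ {{ℚ.nonPositive c₂≤0}} s≤s')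

signChange⇒antitone : ∀ c {s s'} → s <ℚ s' →
  0ℚ ≤ℚ slope c s → slope c s' ≤ℚ 0ℚ → proj₂ c ≤ℚ 0ℚ
signChange⇒antitone (c₁ , c₂) {s} {s'} s<s' 0≤σ σ'≤0 with c₂ ℚP.≤? 0ℚ
... | yes c₂≤0 = c₂≤0
... | no  c₂≰0 = ⊥-elim (ℚP.<-irrefl refl (ℚP.<-≤-trans increase (ℚP.≤-trans σ'≤0 0≤σ)))
  where
  increase : slope (c₁ , c₂) s <ℚ slope (c₁ , c₂) s'
  increase = ℚP.+-monoˡ-< (c₁ - c₂) (ℚP.*-monoʳ-<-pos c₂ {{ℚ.positive (ℚP.≰⇒> c₂≰0)}} s<s')

slope-nonPos-between : ∀ c {s₀ s s₁} → s₀ ≤ℚ s → s ≤ℚ s₁ →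
  slope c s₀ ≤ℚ 0ℚ → slope c s₁ ≤ℚ 0ℚ → slope c s ≤ℚ 0ℚ
slope-nonPos-between (c₁ , c₂) s₀≤s s≤s₁ σ₀≤0 σ₁≤0 with ℚP.≤-total c₂ 0ℚ
... | inj₁ c₂≤0 = ℚP.≤-trans (slope-antitone (c₁ , c₂) c₂≤0 s₀≤s) σ₀≤0
... | inj₂ 0≤c₂ = ℚP.≤-trans (slope-monotone (c₁ , c₂) 0≤c₂ s≤s₁) σ₁≤0

slope-nonNeg-between : ∀ c {s₀ s s₁} → s₀ ≤ℚ s → s ≤ℚ s₁ →
  0ℚ ≤ℚ slope c s₀ → 0ℚ ≤ℚ slope c s₁ → 0ℚ ≤ℚ slope c s
slope-nonNeg-between (c₁ , c₂) s₀≤s s≤s₁ 0≤σ₀ 0≤σ₁ with ℚP.≤-total c₂ 0ℚ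
... | inj₁ c₂≤0 = ℚP.≤-trans 0≤σ₁ (slope-antitone (c₁ , c₂) c₂≤0 s≤s₁)
... | inj₂ 0≤c₂ = ℚP.≤-trans 0≤σ₀ (slope-monotone (c₁ , c₂) 0≤c₂ s₀≤s)

-- Maximizing c · h over an increasing sequence

MaxAt : ℕ → (ℕ → ℚ) → Pt → ℕ → Set
MaxAt n t c i = ∀ {k} → k ℕ.≤ n → c · h (t k) ≤ℚ c · h (t i)

-- By ·h-≤⇔ and ·h-≥⇔ this says that h (t i) maximizes c · h against its two neighbours on the closed
-- polygon h (t 0), …, h (t n); it depends on t only through sums of neighbouring terms.
LocalMaxAt : ℕ → (ℕ → ℚ) → Pt → ℕ → Set
LocalMaxAt n t c i =
  (∀ {j} → i ≡ ℕ.suc j → 0ℚ ≤ℚ slope c (t j + t i)) ×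
  (i ℕ.< n → slope c (t i + t (ℕ.suc i)) ≤ℚ 0ℚ) ×
  (i ≡ 0 → slope c (t 0 + t n) ≤ℚ 0ℚ) ×
  (i ≡ n → 0ℚ ≤ℚ slope c (t 0 + t n))

module IncreasingSequence (n : ℕ) (t : ℕ → ℚ) (t-step : ∀ i → i ℕ.< n → t i <ℚ t (ℕ.suc i)) where

  t-< : ∀ {j k} → j ℕ.< k → k ℕ.≤ n → t j <ℚ t k
  t-< {j} {ℕ.suc k} j<1+k 1+k≤n with ℕP.m≤n⇒m<n∨m≡n (ℕ.s≤s⁻¹ j<1+k)
  ... | inj₁ j<k  = ℚP.<-trans (t-< j<k (ℕP.<⇒≤ 1+k≤n)) (t-step k 1+k≤n)
  ... | inj₂ refl = t-step j 1+k≤n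

  t-≤ : ∀ {j k} → j ℕ.≤ k → k ℕ.≤ n → t j ≤ℚ t k
  t-≤ j≤k k≤n with ℕP.m≤n⇒m<n∨m≡n j≤k
  ... | inj₁ j<k  = ℚP.<⇒≤ (t-< j<k k≤n)
  ... | inj₂ refl = ℚP.≤-refl

  edge-sums-< : ∀ j → ℕ.suc j ℕ.< n → t j + t (ℕ.suc j) <ℚ t (ℕ.suc j) + t (ℕ.suc (ℕ.suc j))
  edge-sums-< j 2+j≤n = subst (_<ℚ t (ℕ.suc j) + t (ℕ.suc (ℕ.suc j))) (ℚP.+-comm (t (ℕ.suc j)) (t j))
    (ℚP.+-monoʳ-< (t (ℕ.suc j)) (t-< (ℕP.n≤1+n (ℕ.suc j)) 2+j≤n))

  maxAt⇒localMaxAt : ∀ c {i} → 1 ℕ.≤ n → i ℕ.≤ n → MaxAt n t c i → LocalMaxAt n t c i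
  maxAt⇒localMaxAt c {i} 1≤n i≤n max = previous , next , first , last
    where
    previous : ∀ {j} → i ≡ ℕ.suc j → 0ℚ ≤ℚ slope c (t j + t i)
    previous {j} refl = Equivalence.to (·h-≤⇔ c (t-step j i≤n)) (max (ℕP.<⇒≤ i≤n))
    next : i ℕ.< n → slope c (t i + t (ℕ.suc i)) ≤ℚ 0ℚ
    next i<n = Equivalence.to (·h-≥⇔ c (t-step i i<n)) (max i<n)
    first : i ≡ 0 → slope c (t 0 + t n) ≤ℚ 0ℚ
    first refl = Equivalence.to (·h-≥⇔ c (t-< 1≤n ℕP.≤-refl)) (max ℕP.≤-refl)
    last : i ≡ n → 0ℚ ≤ℚ slope c (t 0 + t n)
    last refl = Equivalence.to (·h-≤⇔ c (t-< 1≤n ℕP.≤-refl)) (max ℕ.z≤n)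

  localMaxAt⇒slope-later≤0 : ∀ c {i k} → LocalMaxAt n t c i → i ℕ.< k → k ℕ.≤ n →
    slope c (t i + t k) ≤ℚ 0ℚ
  localMaxAt⇒slope-later≤0 c {0} {k} (_ , next , first , _) 0<k k≤n =
    slope-nonPos-between c (ℚP.+-monoʳ-≤ (t 0) (t-≤ 0<k k≤n)) (ℚP.+-monoʳ-≤ (t 0) (t-≤ k≤n ℕP.≤-refl))
      (next (ℕP.<-≤-trans 0<k k≤n)) (first refl)
  localMaxAt⇒slope-later≤0 c {i@(ℕ.suc j)} {k} (previous , next , _ , _) i<k k≤n =
    ℚP.≤-trans (slope-antitone c c₂≤0 (ℚP.+-monoʳ-≤ (t i) (t-≤ i<k k≤n))) (next i<n)
    where
    i<n : i ℕ.< n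
    i<n = ℕP.<-≤-trans i<k k≤n
    c₂≤0 : proj₂ c ≤ℚ 0ℚ
    c₂≤0 = signChange⇒antitone c (edge-sums-< j i<n) (previous refl) (next i<n)

  localMaxAt⇒0≤slope-earlier : ∀ c {i k} → LocalMaxAt n t c i → k ℕ.< i → i ℕ.≤ n →
    0ℚ ≤ℚ slope c (t k + t i)
  localMaxAt⇒0≤slope-earlier c {i@(ℕ.suc j)} {k} (previous , next , _ , last) k<i i≤n
    with ℕP.m≤n⇒m<n∨m≡n i≤n
  ... | inj₁ i<n = ℚP.≤-trans (previous refl) (slope-antitone c c₂≤0 (ℚP.+-monoˡ-≤ (t i) k≤j))
    where
    k≤j : t k ≤ℚ t j
    k≤j = t-≤ (ℕ.s≤s⁻¹ k<i) (ℕP.<⇒≤ i≤n)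
    c₂≤0 : proj₂ c ≤ℚ 0ℚ
    c₂≤0 = signChange⇒antitone c (edge-sums-< j i<n) (previous refl) (next i<n)
  ... | inj₂ i≡n = slope-nonNeg-between c
      (ℚP.+-monoˡ-≤ (t i) (t-≤ ℕ.z≤n (ℕP.<⇒≤ (ℕP.<-≤-trans k<i i≤n))))
      (ℚP.+-monoˡ-≤ (t i) (t-≤ (ℕ.s≤s⁻¹ k<i) (ℕP.<⇒≤ i≤n)))
      (subst (λ m → 0ℚ ≤ℚ slope c (t 0 + t m)) (sym i≡n) (last i≡n)) (previous refl)

  localMaxAt⇒maxAt : ∀ c {i} → i ℕ.≤ n → LocalMaxAt n t c i → MaxAt n t c i
  localMaxAt⇒maxAt c {i} i≤n local {k} k≤n with ℕP.<-cmp i k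
  ... | tri≈ _ refl _ = ℚP.≤-refl
  ... | tri< i<k _ _  = Equivalence.from (·h-≥⇔ c (t-< i<k k≤n)) (localMaxAt⇒slope-later≤0 c local i<k k≤n)
  ... | tri> _ _ k<i  = Equivalence.from (·h-≤⇔ c (t-< k<i i≤n)) (localMaxAt⇒0≤slope-earlier c local k<i i≤n)

maxAt-transfer : ∀ {n t u} →
  (∀ i → i ℕ.< n → t i <ℚ t (ℕ.suc i)) → (∀ i → i ℕ.< n → u i <ℚ u (ℕ.suc i)) → 1 ℕ.≤ n →
  (∀ i → i ℕ.< n → t i + t (ℕ.suc i) ≡ u i + u (ℕ.suc i)) → t 0 + t n ≡ u 0 + u n →
  ∀ c {i} → i ℕ.≤ n → MaxAt n t c i → MaxAt n u c i
maxAt-transfer {n} {t} {u} t-step u-step 1≤n edges ends c {i} i≤n =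
  U.localMaxAt⇒maxAt c i≤n ∘ localTransfer ∘ T.maxAt⇒localMaxAt c 1≤n i≤n
  where
  module T = IncreasingSequence n t t-step
  module U = IncreasingSequence n u u-step
  localTransfer : LocalMaxAt n t c i → LocalMaxAt n u c i
  localTransfer (previous , next , first , last) = previous' , next' , first' , last'
    where
    previous' : ∀ {j} → i ≡ ℕ.suc j → 0ℚ ≤ℚ slope c (u j + u i)
    previous' {j} refl = subst (λ s → 0ℚ ≤ℚ slope c s) (edges j i≤n) (previous refl)
    next' : i ℕ.< n → slope c (u i + u (ℕ.suc i)) ≤ℚ 0ℚ
    next' i<n = subst (λ s → slope c s ≤ℚ 0ℚ) (edges i i<n) (next i<n)
    first' : i ≡ 0 → slope c (u 0 + u n) ≤ℚ 0ℚ
    first' = subst (λ s → slope c s ≤ℚ 0ℚ) ends ∘ first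
    last' : i ≡ n → 0ℚ ≤ℚ slope c (u 0 + u n)
    last' = subst (λ s → 0ℚ ≤ℚ slope c s) ends ∘ last

Enumerates : List Pt → (ℕ → ℚ) → ℕ → Set
Enumerates L s n = ∀ {p} → p ∈ L ⇔ (∃[ k ] k ℕ.≤ n × p ≡ h (s k))

maximizes⇔maxAt : ∀ {L s n} → Enumerates L s n → ∀ c {k} → Maximizes L c (h (s k)) ⇔ MaxAt n s c k
maximizes⇔maxAt {L} {s} {n} L≅s c {k} = mk⇔ to from
  where
  to : Maximizes L c (h (s k)) → MaxAt n s c k
  to max {k'} k'≤n = max (Equivalence.from L≅s (k' , k'≤n , refl))
  from : MaxAt n s c k → Maximizes L c (h (s k))
  from max {q} q∈L =
    let k' , k'≤n , q≡ = Equivalence.to L≅s q∈L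
    in  subst (λ r → c · r ≤ℚ c · h (s k)) (sym q≡) (max k'≤n)

enumerates⇒inConvexPosition : ∀ {L s n} → Enumerates L s n → InConvexPosition L
enumerates⇒inConvexPosition {s = s} L≅s =
  parabola-inConvexPosition λ p∈L → let k , _ , p≡ = Equivalence.to L≅s p∈L in s k , p≡

parabolaPolygons-normallyEquivalent : ∀ {G H n t u} → Enumerates G t n → Enumerates H u n → 1 ℕ.≤ n →
  (∀ i → i ℕ.< n → t i <ℚ t (ℕ.suc i)) → (∀ i → i ℕ.< n → u i <ℚ u (ℕ.suc i)) →
  (∀ i → i ℕ.< n → t i + t (ℕ.suc i) ≡ u i + u (ℕ.suc i)) → t 0 + t n ≡ u 0 + u n →
  NormallyEquivalent G H
parabolaPolygons-normallyEquivalent {G} {H} {n} {t} {u} G≅t H≅u 1≤n t-step u-step edges ends =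
  argmaxCorrespondence⇒normallyEquivalent record
    { _∼_        = _∼_
    ; ∼-∈ˡ       = λ (k , k≤n , p≡ , _) → Equivalence.from G≅t (k , k≤n , p≡)
    ; ∼-∈ʳ       = λ (k , k≤n , _ , q≡) → Equivalence.from H≅u (k , k≤n , q≡)
    ; ∼-totalˡ   = λ p∈G → let k , k≤n , p≡ = Equivalence.to G≅t p∈G in h (u k) , k , k≤n , p≡ , refl
    ; ∼-totalʳ   = λ q∈H → let k , k≤n , q≡ = Equivalence.to H≅u q∈H in h (t k) , k , k≤n , refl , q≡
    ; maximizes⇒ = maximizes⇒
    ; maximizes⇐ = maximizes⇐
    ; convexˡ    = enumerates⇒inConvexPosition G≅t
    ; convexʳ    = enumerates⇒inConvexPosition H≅u
    }
  where
  _∼_ : Pt → Pt → Set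
  p ∼ q = ∃[ k ] k ℕ.≤ n × p ≡ h (t k) × q ≡ h (u k)
  maximizes⇒ : ∀ {p q} c → p ∼ q → Maximizes G c p → Maximizes H c q
  maximizes⇒ c (k , k≤n , refl , refl) =
    Equivalence.from (maximizes⇔maxAt H≅u c)
      ∘ maxAt-transfer t-step u-step 1≤n edges ends c k≤n
      ∘ Equivalence.to (maximizes⇔maxAt G≅t c)
  maximizes⇐ : ∀ {p q} c → p ∼ q → Maximizes H c q → Maximizes G c p
  maximizes⇐ c (k , k≤n , refl , refl) =
    Equivalence.from (maximizes⇔maxAt G≅t c)
      ∘ maxAt-transfer u-step t-step 1≤n (λ i i<n → sym (edges i i<n)) (sym ends) c k≤n
      ∘ Equivalence.to (maximizes⇔maxAt H≅u c)

-- The polygons of the statement, with the denominator MN − 1 replaced by any K > 0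

pairs : (ℕ → ℕ → Pt) → ℕ → List Pt
pairs F m = concatMap (λ j → F j 0 ∷ F j 1 ∷ []) (upTo m)

vPoint : ℕ → ℕ → ℕ → ℕ → Pt
vPoint M K j ℓ = h (frac (2 ℕ.* M ℕ.* (j ℕ.+ ℓ) ℕ.∸ ℓ) K)

wPoint : ℕ → ℕ → ℕ → ℕ → Pt
wPoint M K j ℓ = h (frac (M ℕ.* (2 ℕ.* j ℕ.+ 1) ℕ.∸ (1 ℕ.∸ ℓ)) K)

∈-pairs⁺ : ∀ {F m j ℓ} → j ℕ.< m → ℓ ℕ.≤ 1 → F j ℓ ∈ pairs F m
∈-pairs⁺ {F} j<m ℓ≤1 = ∈-concatMap⁺ (λ j → F j 0 ∷ F j 1 ∷ []) (lose (∈-upTo⁺ j<m) (pair∈ ℓ≤1))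
  where
  pair∈ : ∀ {j ℓ} → ℓ ℕ.≤ 1 → F j ℓ ∈ F j 0 ∷ F j 1 ∷ []
  pair∈ ℕ.z≤n         = here refl
  pair∈ (ℕ.s≤s ℕ.z≤n) = there (here refl)

∈-pairs⁻ : ∀ {F m p} → p ∈ pairs F m → ∃[ j ] ∃[ ℓ ] j ℕ.< m × ℓ ℕ.≤ 1 × p ≡ F j ℓ
∈-pairs⁻ {F} {m} p∈ with find (∈-concatMap⁻ (λ j → F j 0 ∷ F j 1 ∷ []) {xs = upTo m} p∈)
... | j , j∈ , here p≡         = j , 0 , ∈-upTo⁻ j∈ , ℕ.z≤n , p≡
... | j , j∈ , there (here p≡) = j , 1 , ∈-upTo⁻ j∈ , ℕ.s≤s ℕ.z≤n , p≡

pairs-enumerates : ∀ {F s m} → (∀ j ℓ → ℓ ℕ.≤ 1 → F j ℓ ≡ h (s (j ℕ.* 2 ℕ.+ ℓ))) →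
  Enumerates (pairs F (ℕ.suc m)) s (m ℕ.* 2 ℕ.+ 1)
pairs-enumerates {F} {s} {m} F≡ = mk⇔ to from
  where
  to : ∀ {p} → p ∈ pairs F (ℕ.suc m) → ∃[ k ] k ℕ.≤ m ℕ.* 2 ℕ.+ 1 × p ≡ h (s k)
  to p∈ =
    let j , ℓ , j<1+m , ℓ≤1 , p≡ = ∈-pairs⁻ {F} {ℕ.suc m} p∈
    in  j ℕ.* 2 ℕ.+ ℓ , ℕP.+-mono-≤ (ℕP.*-monoˡ-≤ 2 (ℕ.s≤s⁻¹ j<1+m)) ℓ≤1 , trans p≡ (F≡ j ℓ ℓ≤1)
  from : ∀ {p} → ∃[ k ] k ℕ.≤ m ℕ.* 2 ℕ.+ 1 × p ≡ h (s k) → p ∈ pairs F (ℕ.suc m)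
  from (k , k≤n , p≡) = subst (_∈ _) (sym (trans p≡ (trans (cong (h ∘ s) k≡) (sym (F≡ j ℓ ℓ≤1)))))
    (∈-pairs⁺ {F} (ℕP.*-cancelʳ-< 2 j (ℕ.suc m) j*2<) ℓ≤1)
    where
    j ℓ : ℕ
    j = k ℕ./ 2
    ℓ = k ℕ.% 2
    ℓ≤1 : ℓ ℕ.≤ 1
    ℓ≤1 = ℕ.s≤s⁻¹ (m%n<n k 2)
    k≡ : k ≡ j ℕ.* 2 ℕ.+ ℓ
    k≡ = trans (m≡m%n+[m/n]*n k 2) (ℕP.+-comm ℓ (j ℕ.* 2))
    j*2< : j ℕ.* 2 ℕ.< ℕ.suc m ℕ.* 2
    j*2< = ℕP.≤-<-trans (ℕP.≤-trans (ℕP.m≤m+n (j ℕ.* 2) ℓ) (ℕP.≤-reflexive (sym k≡)))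
             (ℕP.<-≤-trans (ℕ.s≤s k≤n) (ℕP.≤-reflexive (cong ℕ.suc (ℕP.+-comm (m ℕ.* 2) 1))))

frac≃ : ∀ a q → ℚ.toℚᵘ (frac a (ℕ.suc q)) ℚᵘ.≃ ℚᵘ.mkℚᵘ (ℤ.+ a) q
frac≃ a q = ℚP.toℚᵘ-fromℚᵘ (ℚᵘ.mkℚᵘ (ℤ.+ a) q)

frac-+ : ∀ a b q → frac a (ℕ.suc q) + frac b (ℕ.suc q) ≡ frac (a ℕ.+ b) (ℕ.suc q)
frac-+ a b q = ℚP.toℚᵘ-injective
  (ℚᵘP.≃-trans (ℚP.toℚᵘ-homo-+ (frac a K) (frac b K))
  (ℚᵘP.≃-trans (ℚᵘP.+-cong (frac≃ a q) (frac≃ b q))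
  (ℚᵘP.≃-trans sum≃ (ℚᵘP.≃-sym (frac≃ (a ℕ.+ b) q)))))
  where
  K : ℕ
  K = ℕ.suc q
  sum≃ : ℚᵘ.mkℚᵘ (ℤ.+ a) q ℚᵘ.+ ℚᵘ.mkℚᵘ (ℤ.+ b) q ℚᵘ.≃ ℚᵘ.mkℚᵘ (ℤ.+ (a ℕ.+ b)) q
  sum≃ = ℚᵘ.*≡* (begin
    (ℤ.+ a ℤ.* ℤ.+ K ℤ.+ ℤ.+ b ℤ.* ℤ.+ K) ℤ.* ℤ.+ K  ≡⟨ common-denominator (ℤ.+ a) (ℤ.+ b) (ℤ.+ K) ⟩
    (ℤ.+ a ℤ.+ ℤ.+ b) ℤ.* (ℤ.+ K ℤ.* ℤ.+ K)          ≡⟨ cong₂ ℤ._*_ (ℤP.pos-+ a b) (ℤP.pos-* K K) ⟨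
    ℤ.+ (a ℕ.+ b) ℤ.* ℤ.+ (K ℕ.* K)                 ∎)
    where
    common-denominator : ∀ a b k → (a ℤ.* k ℤ.+ b ℤ.* k) ℤ.* k ≡ (a ℤ.+ b) ℤ.* (k ℤ.* k)
    common-denominator = ℤ-Solver.solve-∀

frac-< : ∀ {a b} q → a ℕ.< b → frac a (ℕ.suc q) <ℚ frac b (ℕ.suc q)
frac-< {a} {b} q a<b = ℚP.toℚᵘ-cancel-<
  (ℚᵘP.<-respˡ-≃ (ℚᵘP.≃-sym (frac≃ a q)) (ℚᵘP.<-respʳ-≃ (ℚᵘP.≃-sym (frac≃ b q))
    (ℚᵘ.*<* (ℤP.*-monoʳ-<-pos (ℤ.+ ℕ.suc q) (ℤ.+<+ a<b)))))

zigzag : ℕ → ℕ → ℕ → ℕ → ℕ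
zigzag a₀ a₁ d 0                   = a₀
zigzag a₀ a₁ d 1                   = a₁
zigzag a₀ a₁ d (ℕ.suc (ℕ.suc i)) = d ℕ.+ zigzag a₀ a₁ d i

zigzag-< : ∀ {a₀ a₁ d} → a₀ ℕ.< a₁ → a₁ ℕ.< d ℕ.+ a₀ →
  ∀ i → zigzag a₀ a₁ d i ℕ.< zigzag a₀ a₁ d (ℕ.suc i)
zigzag-<         a₀<a₁ a₁<d+a₀ 0                   = a₀<a₁
zigzag-<         a₀<a₁ a₁<d+a₀ 1                   = a₁<d+a₀
zigzag-< {d = d} a₀<a₁ a₁<d+a₀ (ℕ.suc (ℕ.suc i)) = ℕP.+-monoʳ-< d (zigzag-< a₀<a₁ a₁<d+a₀ i)

zigzag-+ : ∀ a₀ a₁ d j ℓ → zigzag a₀ a₁ d (j ℕ.* 2 ℕ.+ ℓ) ≡ j ℕ.* d ℕ.+ zigzag a₀ a₁ d ℓ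
zigzag-+ a₀ a₁ d 0         ℓ = refl
zigzag-+ a₀ a₁ d (ℕ.suc j) ℓ =
  trans (cong (d ℕ.+_) (zigzag-+ a₀ a₁ d j ℓ)) (sym (ℕP.+-assoc d (j ℕ.* d) (zigzag a₀ a₁ d ℓ)))

zigzag-edgeSums : ∀ {a₀ a₁ b₀ b₁} d → a₀ ℕ.+ a₁ ≡ b₀ ℕ.+ b₁ → ∀ i →
  zigzag a₀ a₁ d i ℕ.+ zigzag a₀ a₁ d (ℕ.suc i) ≡ zigzag b₀ b₁ d i ℕ.+ zigzag b₀ b₁ d (ℕ.suc i)
zigzag-edgeSums d a≡b 0 = a≡b
zigzag-edgeSums {a₀} {a₁} {b₀} {b₁} d a≡b 1 = begin
  a₁ ℕ.+ (d ℕ.+ a₀)  ≡⟨ rotate a₁ d a₀ ⟩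
  d ℕ.+ (a₀ ℕ.+ a₁)  ≡⟨ cong (d ℕ.+_) a≡b ⟩
  d ℕ.+ (b₀ ℕ.+ b₁)  ≡⟨ rotate b₁ d b₀ ⟨
  b₁ ℕ.+ (d ℕ.+ b₀)  ∎
  where
  rotate : ∀ x d y → x ℕ.+ (d ℕ.+ y) ≡ d ℕ.+ (y ℕ.+ x)
  rotate = ℕ-Solver.solve-∀
zigzag-edgeSums {a₀} {a₁} {b₀} {b₁} d a≡b (ℕ.suc (ℕ.suc i)) = begin
  (d ℕ.+ zigzag a₀ a₁ d i) ℕ.+ (d ℕ.+ zigzag a₀ a₁ d (ℕ.suc i))
    ≡⟨ shift d _ _ ⟩
  (d ℕ.+ d) ℕ.+ (zigzag a₀ a₁ d i ℕ.+ zigzag a₀ a₁ d (ℕ.suc i))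
    ≡⟨ cong ((d ℕ.+ d) ℕ.+_) (zigzag-edgeSums d a≡b i) ⟩
  (d ℕ.+ d) ℕ.+ (zigzag b₀ b₁ d i ℕ.+ zigzag b₀ b₁ d (ℕ.suc i))
    ≡⟨ shift d _ _ ⟨
  (d ℕ.+ zigzag b₀ b₁ d i) ℕ.+ (d ℕ.+ zigzag b₀ b₁ d (ℕ.suc i))
    ∎
  where
  shift : ∀ d x y → (d ℕ.+ x) ℕ.+ (d ℕ.+ y) ≡ (d ℕ.+ d) ℕ.+ (x ℕ.+ y)
  shift = ℕ-Solver.solve-∀

zigzag-endSums : ∀ {a₀ a₁ b₀ b₁} d → a₀ ℕ.+ a₁ ≡ b₀ ℕ.+ b₁ → ∀ m →
  a₀ ℕ.+ zigzag a₀ a₁ d (m ℕ.* 2 ℕ.+ 1) ≡ b₀ ℕ.+ zigzag b₀ b₁ d (m ℕ.* 2 ℕ.+ 1)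
zigzag-endSums {a₀} {a₁} {b₀} {b₁} d a≡b m = begin
  a₀ ℕ.+ zigzag a₀ a₁ d (m ℕ.* 2 ℕ.+ 1)  ≡⟨ cong (a₀ ℕ.+_) (zigzag-+ a₀ a₁ d m 1) ⟩
  a₀ ℕ.+ (m ℕ.* d ℕ.+ a₁)               ≡⟨ rotate a₀ (m ℕ.* d) a₁ ⟩
  m ℕ.* d ℕ.+ (a₀ ℕ.+ a₁)               ≡⟨ cong (m ℕ.* d ℕ.+_) a≡b ⟩
  m ℕ.* d ℕ.+ (b₀ ℕ.+ b₁)               ≡⟨ rotate b₀ (m ℕ.* d) b₁ ⟨
  b₀ ℕ.+ (m ℕ.* d ℕ.+ b₁)               ≡⟨ cong (b₀ ℕ.+_) (zigzag-+ b₀ b₁ d m 1) ⟨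
  b₀ ℕ.+ zigzag b₀ b₁ d (m ℕ.* 2 ℕ.+ 1)  ∎
  where
  rotate : ∀ x y z → x ℕ.+ (y ℕ.+ z) ≡ y ℕ.+ (x ℕ.+ z)
  rotate = ℕ-Solver.solve-∀

zigzagPolygons-normallyEquivalent : ∀ {F G a₀ a₁ b₀ b₁ d K m} →
  a₀ ℕ.< a₁ → a₁ ℕ.< d ℕ.+ a₀ → b₀ ℕ.< b₁ → b₁ ℕ.< d ℕ.+ b₀ → a₀ ℕ.+ a₁ ≡ b₀ ℕ.+ b₁ →
  (∀ j ℓ → ℓ ℕ.≤ 1 → F j ℓ ≡ h (frac (zigzag a₀ a₁ d (j ℕ.* 2 ℕ.+ ℓ)) (ℕ.suc K))) →
  (∀ j ℓ → ℓ ℕ.≤ 1 → G j ℓ ≡ h (frac (zigzag b₀ b₁ d (j ℕ.* 2 ℕ.+ ℓ)) (ℕ.suc K))) →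
  NormallyEquivalent (pairs F (ℕ.suc m)) (pairs G (ℕ.suc m))
zigzagPolygons-normallyEquivalent {F} {G} {a₀} {a₁} {b₀} {b₁} {d} {K} {m}
  a₀<a₁ a₁<d+a₀ b₀<b₁ b₁<d+b₀ a≡b F≡ G≡ =
  parabolaPolygons-normallyEquivalent {t = t} {u}
    (pairs-enumerates {F} {t} {m} F≡) (pairs-enumerates {G} {u} {m} G≡) (ℕP.m≤n+m 1 (m ℕ.* 2))
    (λ i _ → frac-< K (zigzag-< a₀<a₁ a₁<d+a₀ i)) (λ i _ → frac-< K (zigzag-< b₀<b₁ b₁<d+b₀ i))
    (λ i _ → edges i) ends
  where
  t u : ℕ → ℚ
  t i = frac (zigzag a₀ a₁ d i) (ℕ.suc K)
  u i = frac (zigzag b₀ b₁ d i) (ℕ.suc K)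
  edges : ∀ i → t i + t (ℕ.suc i) ≡ u i + u (ℕ.suc i)
  edges i = begin
    t i + t (ℕ.suc i)             ≡⟨ frac-+ aᵢ aᵢ₊₁ K ⟩
    frac (aᵢ ℕ.+ aᵢ₊₁) (ℕ.suc K)
      ≡⟨ cong (λ a → frac a (ℕ.suc K)) (zigzag-edgeSums {a₀} {a₁} {b₀} {b₁} d a≡b i) ⟩
    frac (bᵢ ℕ.+ bᵢ₊₁) (ℕ.suc K)  ≡⟨ frac-+ bᵢ bᵢ₊₁ K ⟨
    u i + u (ℕ.suc i)             ∎
    where
    aᵢ aᵢ₊₁ bᵢ bᵢ₊₁ : ℕ
    aᵢ   = zigzag a₀ a₁ d i
    aᵢ₊₁ = zigzag a₀ a₁ d (ℕ.suc i)
    bᵢ   = zigzag b₀ b₁ d i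
    bᵢ₊₁ = zigzag b₀ b₁ d (ℕ.suc i)
  n : ℕ
  n = m ℕ.* 2 ℕ.+ 1
  ends : t 0 + t n ≡ u 0 + u n
  ends = begin
    t 0 + t n                                 ≡⟨ frac-+ a₀ (zigzag a₀ a₁ d n) K ⟩
    frac (a₀ ℕ.+ zigzag a₀ a₁ d n) (ℕ.suc K)
      ≡⟨ cong (λ a → frac a (ℕ.suc K)) (zigzag-endSums {a₀} {a₁} {b₀} {b₁} d a≡b m) ⟩
    frac (b₀ ℕ.+ zigzag b₀ b₁ d n) (ℕ.suc K)  ≡⟨ frac-+ b₀ (zigzag b₀ b₁ d n) K ⟨
    u 0 + u n                                 ∎

vPoint-zigzag : ∀ M' K j ℓ → ℓ ℕ.≤ 1 →
  vPoint (ℕ.suc M') K j ℓ ≡ h (frac (zigzag 0 (ℕ.suc M' ℕ.+ M') (ℕ.suc M' ℕ.+ ℕ.suc M') (j ℕ.* 2 ℕ.+ ℓ)) K)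
vPoint-zigzag M' K j 0 _ =
  cong (λ a → h (frac a K)) (trans (lemma M' j) (sym (zigzag-+ 0 (M ℕ.+ M') (M ℕ.+ M) j 0)))
  where
  M : ℕ
  M = ℕ.suc M'
  lemma : ∀ M' j → 2 ℕ.* ℕ.suc M' ℕ.* (j ℕ.+ 0) ≡ j ℕ.* (ℕ.suc M' ℕ.+ ℕ.suc M') ℕ.+ 0
  lemma = ℕ-Solver.solve-∀
vPoint-zigzag M' K j 1 _ =
  cong (λ a → h (frac (a ℕ.∸ 1) K))
    (trans (lemma M' j) (cong ℕ.suc (sym (zigzag-+ 0 (M ℕ.+ M') (M ℕ.+ M) j 1))))
  where
  M : ℕ
  M = ℕ.suc M'
  lemma : ∀ M' j →
    2 ℕ.* ℕ.suc M' ℕ.* (j ℕ.+ 1) ≡ ℕ.suc (j ℕ.* (ℕ.suc M' ℕ.+ ℕ.suc M') ℕ.+ (ℕ.suc M' ℕ.+ M'))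
  lemma = ℕ-Solver.solve-∀
vPoint-zigzag M' K j (ℕ.suc (ℕ.suc ℓ)) (ℕ.s≤s ())

wPoint-zigzag : ∀ M' K j ℓ → ℓ ℕ.≤ 1 →
  wPoint (ℕ.suc M') K j ℓ ≡ h (frac (zigzag M' (ℕ.suc M') (ℕ.suc M' ℕ.+ ℕ.suc M') (j ℕ.* 2 ℕ.+ ℓ)) K)
wPoint-zigzag M' K j 0 _ =
  cong (λ a → h (frac (a ℕ.∸ 1) K))
    (trans (lemma M' j) (cong ℕ.suc (sym (zigzag-+ M' M (M ℕ.+ M) j 0))))
  where
  M : ℕ
  M = ℕ.suc M'
  lemma : ∀ M' j → ℕ.suc M' ℕ.* (2 ℕ.* j ℕ.+ 1) ≡ ℕ.suc (j ℕ.* (ℕ.suc M' ℕ.+ ℕ.suc M') ℕ.+ M')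
  lemma = ℕ-Solver.solve-∀
wPoint-zigzag M' K j 1 _ =
  cong (λ a → h (frac a K)) (trans (lemma M' j) (sym (zigzag-+ M' M (M ℕ.+ M) j 1)))
  where
  M : ℕ
  M = ℕ.suc M'
  lemma : ∀ M' j → ℕ.suc M' ℕ.* (2 ℕ.* j ℕ.+ 1) ≡ j ℕ.* (ℕ.suc M' ℕ.+ ℕ.suc M') ℕ.+ ℕ.suc M'
  lemma = ℕ-Solver.solve-∀
wPoint-zigzag M' K j (ℕ.suc (ℕ.suc ℓ)) (ℕ.s≤s ())

interleaved-normallyEquivalent : ∀ {M K m} → 1 ≤ M → 1 ≤ K → 1 ≤ m →
  NormallyEquivalent (pairs (vPoint M K) m) (pairs (wPoint M K) m)
interleaved-normallyEquivalent {M@(ℕ.suc M')} {K@(ℕ.suc K')} {ℕ.suc m'} _ _ _ =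
  zigzagPolygons-normallyEquivalent
    {vPoint M K} {wPoint M K} {0} {M ℕ.+ M'} {M'} {M} {M ℕ.+ M} {K'} {m'}
    (ℕ.s≤s ℕ.z≤n) (ℕP.<-≤-trans (ℕP.+-monoʳ-< M (ℕP.n<1+n M')) (ℕP.m≤m+n (M ℕ.+ M) 0))
    (ℕP.n<1+n M') (ℕP.<-≤-trans (ℕP.m<m+n M (ℕ.s≤s ℕ.z≤n)) (ℕP.m≤m+n (M ℕ.+ M) M'))
    (ℕP.+-comm M M') (vPoint-zigzag M' K) (wPoint-zigzag M' K)

lemma3p4 : (M N : ℕ) → 2 ∣ M → 2 ∣ N → 2 ≤ M → 4 ≤ N →
    NormallyEquivalent (Vgens M N) (Wgens M N)
lemma3p4 M N _ _ 2≤M 4≤N = interleaved-normallyEquivalent 1≤M 1≤K 1≤m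
  where
  1≤M : 1 ≤ M
  1≤M = ℕP.≤-trans (ℕ.s≤s ℕ.z≤n) 2≤M
  1≤K : 1 ≤ M ℕ.* N ℕ.∸ 1
  1≤K = ℕP.≤-trans (ℕ.s≤s ℕ.z≤n) (ℕP.∸-monoˡ-≤ 1 (ℕP.*-mono-≤ 2≤M 4≤N))
  1≤m : 1 ≤ N ℕ./ 2
  1≤m = ℕP.≤-trans (ℕ.s≤s ℕ.z≤n) (/-monoˡ-≤ 2 4≤N)
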